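{- For every integer $n\ge1$, $$\left\lfloor\left(\sum_{k=n}^\infty\frac{(-1)^k}{B_kB_{k+1}}\right)^{ -1}\right\rfloor=\begin{cases}B_nB_{n+1}+B_{n-1}B_n&\text{if $n$ is even},\\ -(B_nB_{n+1}+B_{n-1}B_n+1)&\text{if $n$ is odd}.\end{cases}$$
   Context: The balancing numbers are defined by $B_0=0$, $B_1=1$, $B_n=6B_{n-1}-B_{n-2}$ for $n\ge 2$. $\lfloor x\rfloor$ denotes the floor of a real number $x$. -}

module Defs where

open import Data.Nat as ℕ using (ℕ; zero; suc)
open import Data.Integer as ℤ using (ℤ; +_; +0; +[1+_]; -[1+_])
open import Data.Rational as ℚ using (ℚ; mkℚ; 0ℚ; 1ℚ; _/_; 1/_; ∣_∣; _≤_; _<_)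
open import Data.Bool using (Bool; true; false; if_then_else_)
open import Data.Product using (Σ; ∃; ∃-syntax; _×_; _,_)

B : ℕ → ℤ
B zero = + 0
B (suc zero) = + 1
B (suc (suc n)) = + 6 ℤ.* B (suc n) ℤ.- B n

isEven : ℕ → Bool
isEven zero = true
isEven (suc n) = if isEven n then false else true

-- reciprocal on ℚ (value at 0 is irrelevant, set to 0)
recip : ℚ → ℚ
recip p@(mkℚ +[1+ _ ] _ _) = 1/ p
recip p@(mkℚ -[1+ _ ] _ _) = 1/ p
recip (mkℚ +0 _ _) = 0ℚ

sgn : ℕ → ℚ
sgn k = if isEven k then 1ℚ else ℚ.- 1ℚ

term : ℕ → ℚ
term k = sgn k ℚ.* recip ((B k ℚ./ 1) ℚ.* (B (suc k) ℚ./ 1))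

partial : ℕ → ℕ → ℚ
partial n zero = term n
partial n (suc N) = partial n N ℚ.+ term (n ℕ.+ suc N)

-- a rational sequence is Cauchy (i.e. converges to a real number)
Cauchy : (ℕ → ℚ) → Set
Cauchy s = ∀ ε → 0ℚ < ε → ∃[ N₀ ] (∀ M N → N₀ ℕ.≤ M → N₀ ℕ.≤ N → ∣ s M ℚ.- s N ∣ < ε)

-- for a convergent sequence s: lim s ≥ c
LimGE : (ℕ → ℚ) → ℚ → Set
LimGE s c = ∀ ε → 0ℚ < ε → ∃[ N₀ ] (∀ N → N₀ ℕ.≤ N → c ℚ.- ε ≤ s N)

-- for a convergent sequence s: lim s < c
LimLT : (ℕ → ℚ) → ℚ → Set
LimLT s c = ∃[ δ ] (0ℚ < δ × ∃[ N₀ ] (∀ N → N₀ ℕ.≤ N → s N ℚ.+ δ ≤ c))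

rhs : ℕ → ℤ
rhs zero = + 0
rhs (suc k) = if isEven (suc k)
  then B (suc k) ℤ.* B (suc (suc k)) ℤ.+ B k ℤ.* B (suc k)
  else ℤ.- (B (suc k) ℤ.* B (suc (suc k)) ℤ.+ B k ℤ.* B (suc k) ℤ.+ + 1)

-- ⌊ (Σ_{k≥n} term k)^{-1} ⌋ = m, expressed as: the series converges
-- (partial sums Cauchy) and the reciprocals of the partial sums converge
-- to a limit L with m ≤ L < m + 1.
FloorRecipSeries : ℕ → ℤ → Set
FloorRecipSeries n m =
  Cauchy (partial n) ×
  LimGE (λ N → recip (partial n N)) (m ℚ./ 1) ×
  LimLT (λ N → recip (partial n N)) ((m ℤ.+ + 1) ℚ./ 1)

{-# OPTIONS --safe #-}
-- Write x_k = B_{k+1} and τ_k = 1/(x_k x_{k+1}); for n = m + 1 the tail of the series is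
-- (-1)^n (τ_m - τ_{m+1} + τ_{m+2} - ⋯). With ρ_q(u) = 1/(6u² + 1/q), the relations
-- x_{k+2} + x_k = 6 x_{k+1} and x_k² + x_{k+1}² = 6 x_k x_{k+1} + 1 give
--   τ_k - τ_{k+1} ≤ ρ₁₀(x_k) - ρ₁₀(x_{k+2})   and   ρ₄(x_k) + ρ₁₀(x_{k+1}) ≤ τ_k.
-- Telescoping the first inequality over pairs of terms, every alternating partial sum
-- τ_m - ⋯ ± τ_K lies within τ_K of [ρ₄(x_m), ρ₁₀(x_m)], so for large K it lies in
-- [ρ₂(x_m), ρ₂₀(x_m)] and its reciprocal in [6x_m² + 1/20, 6x_m² + 1/2]. Finally
-- B_n B_{n+1} + B_{n-1} B_n = B_n (B_{n+1} + B_{n-1}) = 6 x_m², which gives both floors.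
module Submission where

open import Defs

module BalancingNumbers where

  open import Data.Nat
  open import Data.Nat.Properties
  open import Data.Nat.Tactic.RingSolver using (solve-∀; solve)
  open import Data.List.Base using ([]; _∷_)
  open import Relation.Binary.PropositionalEquality

  m+k≡n⇒m≤n : ∀ {m n} k → m + k ≡ n → m ≤ n
  m+k≡n⇒m≤n {m} k refl = m≤m+n m k

  b : ℕ → ℕ
  b zero = 0
  b (suc zero) = 1
  b (suc (suc k)) = 6 * b (suc k) ∸ b k

  b-<-suc : ∀ k → b k < b (suc k)

  b-≤-6* : ∀ k → b k ≤ 6 * b (suc k)
  b-≤-6* k = ≤-trans (<⇒≤ (b-<-suc k)) (m≤n*m (b (suc k)) 6)

  b-recurrence : ∀ k → b (suc (suc k)) + b k ≡ 6 * b (suc k)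
  b-recurrence k = m∸n+n≡m (b-≤-6* k)

  b-<-suc zero = s≤s z≤n
  b-<-suc (suc k) = +-cancelʳ-≤ (b k) (suc y) (b (suc (suc k))) (begin
      suc y + b k           ≡⟨ +-suc y (b k) ⟨
      y + suc (b k)         ≤⟨ +-monoʳ-≤ y (b-<-suc k) ⟩
      y + y                 ≤⟨ m+k≡n⇒m≤n (4 * y) (sixfold y) ⟩
      6 * y                 ≡⟨ b-recurrence k ⟨
      b (suc (suc k)) + b k ∎)
    where
    open ≤-Reasoning
    y = b (suc k)
    sixfold : ∀ y → y + y + 4 * y ≡ 6 * y
    sixfold = solve-∀

  index≤b : ∀ k → k ≤ b k
  index≤b zero = z≤n
  index≤b (suc k) = ≤-trans (s≤s (index≤b k)) (b-<-suc k)

  -- telescoping-cross, ρ-below-τ-cross and ρ-gap-cross below are the inequalities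
  -- τ_k + ρ₁₀(x_{k+2}) ≤ ρ₁₀(x_k) + τ_{k+1}, ρ₄(x_k) + ρ₁₀(x_{k+1}) ≤ τ_k and ρ_q(u) + 1/w ≤ ρ_{2q}(u)
  -- cross-multiplied, in exactly the shape produced by frac-+ and frac-mono-≤ in AlternatingSeries.

  quadratic-bound : ∀ w → 2 ≤ w → 1 + 60 * (34 * w + 36) + 3600 * (w * w) ≤ 3600 * w * (w + 1)
  quadratic-bound w 2≤w = begin
    1 + 60 * (34 * w + 36) + 3600 * (w * w) ≡⟨ solve (w ∷ []) ⟩
    3600 * (w * w) + 2040 * w + 2161        ≤⟨ +-monoʳ-≤ (3600 * (w * w) + 2040 * w)
                                                 (≤-trans (m+k≡n⇒m≤n {2161} 959 refl) (*-monoʳ-≤ 1560 2≤w)) ⟩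
    3600 * (w * w) + 2040 * w + 1560 * w    ≡⟨ solve (w ∷ []) ⟩
    3600 * w * (w + 1)                      ∎
    where open ≤-Reasoning

  -- With z = x + d and Q = P + 360 d y: the right-hand side minus the left-hand side of
  -- telescoping-cross-core is y d (3600 x z y² - P Q).
  telescoping-identity : ∀ x y d P →
    let z = x + d ; Q = P + 360 * d * y in
    (1 * Q + 10 * (x * y)) * (P * (y * z)) + y * d * (3600 * (x * z) * (y * y))
      ≡ (10 * (y * z) + 1 * P) * ((x * y) * Q) + y * d * (P * Q)
  telescoping-identity = solve-∀

  telescoping-cross-core : ∀ x y d P Q → Q ≡ P + 360 * d * y → P * Q ≤ 3600 * (x * (x + d)) * (y * y) →
    (1 * Q + 10 * (x * y)) * (P * (y * (x + d))) ≤ (10 * (y * (x + d)) + 1 * P) * ((x * y) * Q)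
  telescoping-cross-core x y d P _ refl PQ≤ =
    +-cancelʳ-≤ (y * d * (P * _)) _ _ (≤-trans (+-monoʳ-≤ _ (*-monoʳ-≤ (y * d) PQ≤))
                                               (≤-reflexive (telescoping-identity x y d P)))

  module _ {x y z : ℕ} (recurrence : z + x ≡ 6 * y) (cassini : x * x + y * y ≡ 6 * x * y + 1) where

    middle-square : x * z + 1 ≡ y * y
    middle-square = +-cancelʳ-≡ (x * x) (x * z + 1) (y * y) (begin
      x * z + 1 + x * x ≡⟨ solve (x ∷ z ∷ []) ⟩
      x * (z + x) + 1   ≡⟨ cong (λ s → x * s + 1) recurrence ⟩
      x * (6 * y) + 1   ≡⟨ solve (x ∷ y ∷ []) ⟩
      6 * x * y + 1     ≡⟨ cassini ⟨
      x * x + y * y     ≡⟨ +-comm (x * x) (y * y) ⟩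
      y * y + x * x     ∎)
      where open ≡-Reasoning

    cassini-next : y * y + z * z ≡ 6 * y * z + 1
    cassini-next = begin
      y * y + z * z     ≡⟨ cong (_+ z * z) middle-square ⟨
      x * z + 1 + z * z ≡⟨ solve (x ∷ z ∷ []) ⟩
      z * (z + x) + 1   ≡⟨ cong (λ s → z * s + 1) recurrence ⟩
      z * (6 * y) + 1   ≡⟨ solve (y ∷ z ∷ []) ⟩
      6 * y * z + 1     ∎
      where open ≡-Reasoning

    outer-square-sum : x * x + z * z ≡ 34 * (x * z) + 36
    outer-square-sum = +-cancelʳ-≡ (2 * (x * z)) _ _ (begin
      x * x + z * z + 2 * (x * z)     ≡⟨ solve (x ∷ z ∷ []) ⟩
      (z + x) * (z + x)               ≡⟨ cong (λ s → s * s) recurrence ⟩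
      (6 * y) * (6 * y)               ≡⟨ solve (y ∷ []) ⟩
      36 * (y * y)                    ≡⟨ cong (36 *_) middle-square ⟨
      36 * (x * z + 1)                ≡⟨ solve (x ∷ z ∷ []) ⟩
      34 * (x * z) + 36 + 2 * (x * z) ∎)
      where open ≡-Reasoning

    outer-product-bound : 2 ≤ x * z → (1 + 60 * (x * x)) * (1 + 60 * (z * z)) ≤ 3600 * (x * z) * (y * y)
    outer-product-bound 2≤xz = begin
      (1 + 60 * (x * x)) * (1 + 60 * (z * z))                    ≡⟨ solve (x ∷ z ∷ []) ⟩
      1 + 60 * (x * x + z * z) + 3600 * ((x * z) * (x * z))      ≡⟨ cong (λ s → 1 + 60 * s + 3600 * ((x * z) * (x * z)))
                                                                         outer-square-sum ⟩
      1 + 60 * (34 * (x * z) + 36) + 3600 * ((x * z) * (x * z)) ≤⟨ quadratic-bound (x * z) 2≤xz ⟩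
      3600 * (x * z) * (x * z + 1)                               ≡⟨ cong (3600 * (x * z) *_) middle-square ⟩
      3600 * (x * z) * (y * y)                                   ∎
      where open ≤-Reasoning

    telescoping-cross : x ≤ z → 2 ≤ x * z →
      (1 * (1 + 60 * (z * z)) + 10 * (x * y)) * ((1 + 60 * (x * x)) * (y * z))
        ≤ (10 * (y * z) + 1 * (1 + 60 * (x * x))) * ((x * y) * (1 + 60 * (z * z)))
    telescoping-cross x≤z 2≤xz with z ∸ x | m+[n∸m]≡n x≤z
    ... | d | refl = telescoping-cross-core x y d (1 + 60 * (x * x)) _ outer-square-step (outer-product-bound 2≤xz)
      where
      outer-square-step : 1 + 60 * ((x + d) * (x + d)) ≡ 1 + 60 * (x * x) + 360 * d * y
      outer-square-step = begin
        1 + 60 * ((x + d) * (x + d))            ≡⟨ solve (x ∷ d ∷ []) ⟩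
        1 + 60 * (x * x) + 60 * d * (x + d + x) ≡⟨ cong (λ s → 1 + 60 * (x * x) + 60 * d * s) recurrence ⟩
        1 + 60 * (x * x) + 60 * d * (6 * y)     ≡⟨ solve (x ∷ y ∷ d ∷ []) ⟩
        1 + 60 * (x * x) + 360 * d * y          ∎
        where open ≡-Reasoning

  ρ-below-τ-cross : ∀ {x y} → x * x + y * y ≡ 6 * x * y + 1 → x ≤ y →
    (4 * (1 + 60 * (y * y)) + 10 * (1 + 24 * (x * x))) * (x * y) ≤ 1 * ((1 + 24 * (x * x)) * (1 + 60 * (y * y)))
  ρ-below-τ-cross {x} {y} cassini x≤y = begin
    (4 * (1 + 60 * (y * y)) + 10 * (1 + 24 * (x * x))) * (x * y) ≡⟨ solve (x ∷ y ∷ []) ⟩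
    14 * (x * y) + 240 * (x * y) * (x * x + y * y)                ≡⟨ cong (λ s → 14 * (x * y) + 240 * (x * y) * s) cassini ⟩
    14 * (x * y) + 240 * (x * y) * (6 * x * y + 1)                ≡⟨ solve (x ∷ y ∷ []) ⟩
    254 * (x * y) + 1440 * ((x * y) * (x * y))                     ≤⟨ +-monoˡ-≤ _ linear-part ⟩
    1 + 24 * (x * x) + 60 * (y * y) + 1440 * ((x * y) * (x * y))   ≡⟨ solve (x ∷ y ∷ []) ⟩
    1 * ((1 + 24 * (x * x)) * (1 + 60 * (y * y)))                  ∎
    where
    open ≤-Reasoning
    linear-part : 254 * (x * y) ≤ 1 + 24 * (x * x) + 60 * (y * y)
    linear-part = +-cancelʳ-≤ (36 * (x * x)) _ _ (begin
      254 * (x * y) + 36 * (x * x)                   ≤⟨ +-monoʳ-≤ (254 * (x * y)) (*-monoʳ-≤ 36 (*-monoʳ-≤ x x≤y)) ⟩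
      254 * (x * y) + 36 * (x * y)                   ≤⟨ m+k≡n⇒m≤n (61 + 70 * (x * y)) (solve (x ∷ y ∷ [])) ⟩
      1 + 60 * (6 * x * y + 1)                       ≡⟨ cong (λ s → 1 + 60 * s) cassini ⟨
      1 + 60 * (x * x + y * y)                       ≡⟨ solve (x ∷ y ∷ []) ⟩
      1 + 24 * (x * x) + 60 * (y * y) + 36 * (x * x) ∎)

  ρ-gap-cross : ∀ q u w → (1 + 6 * q * u) * (1 + 6 * (2 * q) * u) ≤ q * w →
    (q * w + 1 * (1 + 6 * q * u)) * (1 + 6 * (2 * q) * u) ≤ 2 * q * ((1 + 6 * q * u) * w)
  ρ-gap-cross q u w hyp = begin
    (q * w + 1 * (1 + 6 * q * u)) * (1 + 6 * (2 * q) * u)                   ≡⟨ solve (q ∷ u ∷ w ∷ []) ⟩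
    q * w * (1 + 6 * (2 * q) * u) + (1 + 6 * q * u) * (1 + 6 * (2 * q) * u) ≤⟨ +-monoʳ-≤ _ hyp ⟩
    q * w * (1 + 6 * (2 * q) * u) + q * w                                    ≡⟨ solve (q ∷ u ∷ w ∷ []) ⟩
    2 * q * ((1 + 6 * q * u) * w)                                            ∎
    where open ≤-Reasoning

  b-cassini : ∀ k → b k * b k + b (suc k) * b (suc k) ≡ 6 * b k * b (suc k) + 1
  b-cassini zero = refl
  b-cassini (suc k) = cassini-next {b k} {b (suc k)} {b (suc (suc k))} (b-recurrence k) (b-cassini k)

  -- b⁺ k = b (k + 1), written as a successor so that denominators built from it are visibly nonzero.
  b⁺ : ℕ → ℕ
  b⁺ k = suc (pred (b (suc k)))

  b⁺≡b : ∀ k → b⁺ k ≡ b (suc k)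
  b⁺≡b k = suc-pred (b (suc k)) {{>-nonZero (≤-<-trans z≤n (b-<-suc k))}}

  b⁺-recurrence : ∀ k → b⁺ (suc (suc k)) + b⁺ k ≡ 6 * b⁺ (suc k)
  b⁺-recurrence k = begin
    b⁺ (suc (suc k)) + b⁺ k           ≡⟨ cong₂ _+_ (b⁺≡b (suc (suc k))) (b⁺≡b k) ⟩
    b (suc (suc (suc k))) + b (suc k) ≡⟨ b-recurrence (suc k) ⟩
    6 * b (suc (suc k))               ≡⟨ cong (6 *_) (b⁺≡b (suc k)) ⟨
    6 * b⁺ (suc k)                    ∎
    where open ≡-Reasoning

  b⁺-cassini : ∀ k → b⁺ k * b⁺ k + b⁺ (suc k) * b⁺ (suc k) ≡ 6 * b⁺ k * b⁺ (suc k) + 1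
  b⁺-cassini k = subst₂ (λ y z → y * y + z * z ≡ 6 * y * z + 1) (sym (b⁺≡b k)) (sym (b⁺≡b (suc k)))
                        (b-cassini (suc k))

  b⁺-<-suc : ∀ k → b⁺ k < b⁺ (suc k)
  b⁺-<-suc k = subst₂ _<_ (sym (b⁺≡b k)) (sym (b⁺≡b (suc k))) (b-<-suc (suc k))

  index<b⁺ : ∀ k → k < b⁺ k
  index<b⁺ k = subst (k <_) (sym (b⁺≡b k)) (≤-<-trans (index≤b k) (b-<-suc k))

module AlternatingSeries where

  open import Data.Nat as ℕ using (ℕ; zero; suc)
  import Data.Nat.Properties as ℕP
  import Data.Nat.Tactic.RingSolver as ℕ-Ring
  open import Data.Integer.Base as ℤ using (ℤ; +_; +0)
  import Data.Integer.Properties as ℤP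
  import Data.Integer.Tactic.RingSolver as ℤ-Ring
  open import Data.Rational
  open import Data.Rational.Properties
  open import Data.Rational.Unnormalised as ℚᵘ using (mkℚᵘ; *≡*; *≤*; *<*)
  import Data.Rational.Unnormalised.Properties as ℚᵘP
  open import Data.Bool.Base using (true; false; if_then_else_)
  open import Data.Maybe.Base using (just; nothing)
  open import Data.Product using (_×_; _,_; proj₁; proj₂; ∃-syntax)
  open import Data.Sum using (inj₁; inj₂)
  open import Level using (0ℓ)
  open import Relation.Binary.PropositionalEquality
  open import Tactic.RingSolver using (solve-∀)
  open import Tactic.RingSolver.Core.AlmostCommutativeRing using (AlmostCommutativeRing; fromCommutativeRing)
  open BalancingNumbers using (m+k≡n⇒m≤n; b; b-≤-6*; b⁺; b⁺≡b; b⁺-recurrence; b⁺-cassini; b⁺-<-suc; index<b⁺;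
                               telescoping-cross; ρ-below-τ-cross; ρ-gap-cross)

  ℚ-ring : AlmostCommutativeRing 0ℓ 0ℓ
  ℚ-ring = fromCommutativeRing +-*-commutativeRing λ { (mkℚ +0 zero _) → just refl ; _ → nothing }

  -- Opaque, so that unification can read the numerator and denominator off a fraction.
  opaque
    frac : ℕ → (q : ℕ) → .{{ℕ.NonZero q}} → ℚ
    frac p q = + p / q

  opaque
    unfolding frac

    frac≡/ : ∀ p q .{{_ : ℕ.NonZero q}} → frac p q ≡ + p / q
    frac≡/ p q = refl

    toℚᵘ-frac : ∀ p q → toℚᵘ (frac p (suc q)) ℚᵘ.≃ mkℚᵘ (+ p) q
    toℚᵘ-frac p q = toℚᵘ-fromℚᵘ (mkℚᵘ (+ p) q)

  frac-mono-≤ : ∀ {a b c d} {{_ : ℕ.NonZero b}} {{_ : ℕ.NonZero d}} → a ℕ.* d ℕ.≤ c ℕ.* b → frac a b ≤ frac c d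
  frac-mono-≤ {a} {suc b} {c} {suc d} h = toℚᵘ-cancel-≤
    (ℚᵘP.≤-respˡ-≃ (ℚᵘP.≃-sym (toℚᵘ-frac a b)) (ℚᵘP.≤-respʳ-≃ (ℚᵘP.≃-sym (toℚᵘ-frac c d))
      (*≤* (subst₂ ℤ._≤_ (ℤP.pos-* a (suc d)) (ℤP.pos-* c (suc b)) (ℤ.+≤+ h)))))

  frac-mono-< : ∀ {a b c d} {{_ : ℕ.NonZero b}} {{_ : ℕ.NonZero d}} → a ℕ.* d ℕ.< c ℕ.* b → frac a b < frac c d
  frac-mono-< {a} {suc b} {c} {suc d} h = toℚᵘ-cancel-<
    (ℚᵘP.<-respˡ-≃ (ℚᵘP.≃-sym (toℚᵘ-frac a b)) (ℚᵘP.<-respʳ-≃ (ℚᵘP.≃-sym (toℚᵘ-frac c d))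
      (*<* (subst₂ ℤ._<_ (ℤP.pos-* a (suc d)) (ℤP.pos-* c (suc b)) (ℤ.+<+ h)))))

  frac-cong : ∀ {a b c d} {{_ : ℕ.NonZero b}} {{_ : ℕ.NonZero d}} → a ℕ.* d ≡ c ℕ.* b → frac a b ≡ frac c d
  frac-cong {a} {suc b} {c} {suc d} h = toℚᵘ-injective (ℚᵘP.≃-trans (toℚᵘ-frac a b) (ℚᵘP.≃-trans
    (*≡* (trans (sym (ℤP.pos-* a (suc d))) (trans (cong +_ h) (ℤP.pos-* c (suc b))))) (ℚᵘP.≃-sym (toℚᵘ-frac c d))))

  frac-+ : ∀ a b c d {{_ : ℕ.NonZero b}} {{_ : ℕ.NonZero d}} →
           frac a b + frac c d ≡ (frac (a ℕ.* d ℕ.+ c ℕ.* b) (b ℕ.* d)) {{ℕP.m*n≢0 b d}}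
  frac-+ a (suc b) c (suc d) = toℚᵘ-injective (ℚᵘP.≃-trans (toℚᵘ-homo-+ (frac a (suc b)) (frac c (suc d)))
    (ℚᵘP.≃-trans (ℚᵘP.+-cong (toℚᵘ-frac a b) (toℚᵘ-frac c d))
      (ℚᵘP.≃-trans (ℚᵘP.≃-reflexive (cong (λ i → mkℚᵘ i _) numerator)) (ℚᵘP.≃-sym (toℚᵘ-frac _ _)))))
    where
    numerator : + a ℤ.* + suc d ℤ.+ + c ℤ.* + suc b ≡ + (a ℕ.* suc d ℕ.+ c ℕ.* suc b)
    numerator = sym (trans (ℤP.pos-+ (a ℕ.* suc d) (c ℕ.* suc b))
                           (cong₂ ℤ._+_ (ℤP.pos-* a (suc d)) (ℤP.pos-* c (suc b))))

  frac-* : ∀ a b c d {{_ : ℕ.NonZero b}} {{_ : ℕ.NonZero d}} →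
           frac a b * frac c d ≡ (frac (a ℕ.* c) (b ℕ.* d)) {{ℕP.m*n≢0 b d}}
  frac-* a (suc b) c (suc d) = toℚᵘ-injective (ℚᵘP.≃-trans (toℚᵘ-homo-* (frac a (suc b)) (frac c (suc d)))
    (ℚᵘP.≃-trans (ℚᵘP.*-cong (toℚᵘ-frac a b) (toℚᵘ-frac c d))
      (ℚᵘP.≃-trans (ℚᵘP.≃-reflexive (cong (λ i → mkℚᵘ i _) (sym (ℤP.pos-* a c)))) (ℚᵘP.≃-sym (toℚᵘ-frac _ _)))))

  frac-nonneg : ∀ {a b} {{_ : ℕ.NonZero b}} → 0ℚ ≤ frac a b
  frac-nonneg {a} {b} = subst (_≤ frac a b) (frac≡/ 0 1) (frac-mono-≤ ℕ.z≤n)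

  frac-pos : ∀ {a b} {{_ : ℕ.NonZero b}} → 0ℚ < frac (suc a) b
  frac-pos {a} {b} = subst (_< frac (suc a) b) (frac≡/ 0 1) (frac-mono-< ℕ.z<s)

  neg-frac : ∀ n → (ℤ.- + n) / 1 ≡ - frac n 1
  neg-frac zero = cong -_ (sym (frac≡/ 0 1))
  neg-frac (suc n) = cong -_ (sym (frac≡/ (suc n) 1))

  -- Order, reciprocals and limits

  diff-nonneg : ∀ {p q} → p ≤ q → 0ℚ ≤ q - p
  diff-nonneg {p} {q} p≤q = subst (_≤ q - p) (+-inverseʳ p) (+-monoˡ-≤ (- p) p≤q)

  diff-pos : ∀ {p q} → p < q → 0ℚ < q - p
  diff-pos {p} {q} p<q = subst (_< q - p) (+-inverseʳ p) (+-monoˡ-< (- p) p<q)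

  ≤-by-diff : ∀ {p q p₁ q₁} → p₁ ≤ q₁ → q₁ - p₁ ≡ q - p → p ≤ q
  ≤-by-diff {p} {q} p₁≤q₁ eq = begin
    p             ≡⟨ +-identityʳ p ⟨
    p + 0ℚ        ≤⟨ +-monoʳ-≤ p (subst (0ℚ ≤_) eq (diff-nonneg p₁≤q₁)) ⟩
    p + (q - p)   ≡⟨ cancel p q ⟩
    q             ∎
    where
    open ≤-Reasoning
    cancel : ∀ p q → p + (q - p) ≡ q
    cancel = solve-∀ ℚ-ring

  p-q≤p : ∀ {p q} → 0ℚ ≤ q → p - q ≤ p
  p-q≤p {p} {q} 0≤q = ≤-by-diff 0≤q (identity p q)
    where
    identity : ∀ p q → q - 0ℚ ≡ p - (p - q)
    identity = solve-∀ ℚ-ring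

  ∣p-q∣≤r : ∀ {p q r} → 0ℚ ≤ p → p ≤ r → 0ℚ ≤ q → q ≤ r → ∣ p - q ∣ ≤ r
  ∣p-q∣≤r {p} {q} 0≤p p≤r 0≤q q≤r with ∣p∣≡p∨∣p∣≡-p (p - q)
  ... | inj₁ eq = subst (_≤ _) (sym eq) (≤-trans (p-q≤p 0≤q) p≤r)
  ... | inj₂ eq = subst (_≤ _) (sym (trans eq (identity p q))) (≤-trans (p-q≤p 0≤p) q≤r)
    where
    identity : ∀ p q → - (p - q) ≡ q - p
    identity = solve-∀ ℚ-ring

  recip≡1/ : ∀ p {{_ : NonZero p}} → recip p ≡ 1/ p
  recip≡1/ (mkℚ ℤ.+[1+ _ ] _ _) = refl
  recip≡1/ (mkℚ ℤ.-[1+ _ ] _ _) = refl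

  recip-neg : ∀ p → recip (- p) ≡ - recip p
  recip-neg (mkℚ ℤ.+[1+ _ ] _ _) = refl
  recip-neg (mkℚ +0 _ _) = refl
  recip-neg (mkℚ ℤ.-[1+ _ ] _ _) = refl

  module _ {p} (0<p : 0ℚ < p) where

    private instance
      p≢0 : NonZero p
      p≢0 = pos⇒nonZero p {{positive 0<p}}

    recip-pos : 0ℚ < recip p
    recip-pos = subst (0ℚ <_) (sym (recip≡1/ p)) (positive⁻¹ (1/ p) {{1/pos⇒pos p {{positive 0<p}}}})

    recip-inverseʳ : p * recip p ≡ 1ℚ
    recip-inverseʳ = trans (cong (p *_) (recip≡1/ p)) (*-inverseʳ p)

    recip-unique : ∀ {q} → p * q ≡ 1ℚ → recip p ≡ q
    recip-unique {q} pq≡1 = begin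
      recip p             ≡⟨ *-identityʳ (recip p) ⟨
      recip p * 1ℚ        ≡⟨ cong (recip p *_) pq≡1 ⟨
      recip p * (p * q)   ≡⟨ *-assoc (recip p) p q ⟨
      (recip p * p) * q   ≡⟨ cong (_* q) (trans (*-comm (recip p) p) recip-inverseʳ) ⟩
      1ℚ * q              ≡⟨ *-identityˡ q ⟩
      q                   ∎
      where open ≡-Reasoning

  recip-antitone : ∀ {p q} → 0ℚ < p → p ≤ q → recip q ≤ recip p
  recip-antitone {p} {q} 0<p p≤q = begin
    recip q                   ≡⟨ *-identityʳ (recip q) ⟨
    recip q * 1ℚ              ≡⟨ cong (recip q *_) (recip-inverseʳ 0<p) ⟨
    recip q * (p * recip p)   ≡⟨ *-assoc (recip q) p (recip p) ⟨
    (recip q * p) * recip p   ≤⟨ *-monoʳ-≤-nonNeg (recip p) {{nonNegative (<⇒≤ (recip-pos 0<p))}}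
                                   (*-monoˡ-≤-nonNeg (recip q) {{nonNegative (<⇒≤ (recip-pos 0<q))}} p≤q) ⟩
    (recip q * q) * recip p   ≡⟨ cong (_* recip p) (trans (*-comm (recip q) q) (recip-inverseʳ 0<q)) ⟩
    1ℚ * recip p              ≡⟨ *-identityˡ (recip p) ⟩
    recip p                   ∎
    where
    open ≤-Reasoning
    0<q = <-≤-trans 0<p p≤q

  recip-frac : ∀ a b → recip (frac (suc a) (suc b)) ≡ frac (suc b) (suc a)
  recip-frac a b = recip-unique (frac-pos {a} {suc b}) (begin
    frac (suc a) (suc b) * frac (suc b) (suc a) ≡⟨ frac-* (suc a) (suc b) (suc b) (suc a) ⟩
    frac (suc a ℕ.* suc b) (suc b ℕ.* suc a)    ≡⟨ frac-cong cross ⟩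
    frac 1 1                                    ≡⟨ frac≡/ 1 1 ⟩
    1ℚ                                          ∎)
    where
    open ≡-Reasoning
    cross : suc a ℕ.* suc b ℕ.* 1 ≡ 1 ℕ.* (suc b ℕ.* suc a)
    cross = trans (ℕP.*-identityʳ _) (trans (ℕP.*-comm (suc a) (suc b)) (sym (ℕP.*-identityˡ _)))

  Eventually : (ℕ → Set) → Set
  Eventually P = ∃[ N₀ ] (∀ N → N₀ ℕ.≤ N → P N)

  eventually-≥⇒LimGE : ∀ {s c} → Eventually (λ N → c ≤ s N) → LimGE s c
  eventually-≥⇒LimGE (N₀ , bound) ε 0<ε = N₀ , λ N N₀≤N → ≤-trans (p-q≤p (<⇒≤ 0<ε)) (bound N N₀≤N)

  eventually-≤⇒LimLT : ∀ {s c d} → d < c → Eventually (λ N → s N ≤ d) → LimLT s c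
  eventually-≤⇒LimLT {s} {c} {d} d<c (N₀ , bound) = c - d , diff-pos d<c , N₀ , λ N N₀≤N →
    ≤-trans (+-monoˡ-≤ (c - d) (bound N N₀≤N)) (≤-reflexive (identity d c))
    where
    identity : ∀ d c → d + (c - d) ≡ c
    identity = solve-∀ ℚ-ring

  -- Signs and alternating sums

  sgn-suc : ∀ k → sgn (suc k) ≡ - sgn k
  sgn-suc k with isEven k
  ... | true = refl
  ... | false = refl

  sgn-+ : ∀ m k → sgn (m ℕ.+ k) ≡ sgn m * sgn k
  sgn-+ zero k = sym (*-identityˡ (sgn k))
  sgn-+ (suc m) k = begin
    sgn (suc (m ℕ.+ k))   ≡⟨ sgn-suc (m ℕ.+ k) ⟩
    - sgn (m ℕ.+ k)       ≡⟨ cong -_ (sgn-+ m k) ⟩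
    - (sgn m * sgn k)     ≡⟨ neg-distribˡ-* (sgn m) (sgn k) ⟩
    - sgn m * sgn k       ≡⟨ cong (_* sgn k) (sgn-suc m) ⟨
    sgn (suc m) * sgn k   ∎
    where open ≡-Reasoning

  ∣sgn∣ : ∀ k → ∣ sgn k ∣ ≡ 1ℚ
  ∣sgn∣ k with isEven k
  ... | true = refl
  ... | false = refl

  ∣sgn*p-sgn*q∣ : ∀ k p q → ∣ sgn k * p - sgn k * q ∣ ≡ ∣ p - q ∣
  ∣sgn*p-sgn*q∣ k p q = begin
    ∣ sgn k * p - sgn k * q ∣   ≡⟨ cong ∣_∣ (identity (sgn k) p q) ⟩
    ∣ sgn k * (p - q) ∣         ≡⟨ ∣p*q∣≡∣p∣*∣q∣ (sgn k) (p - q) ⟩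
    ∣ sgn k ∣ * ∣ p - q ∣       ≡⟨ cong (_* ∣ p - q ∣) (∣sgn∣ k) ⟩
    1ℚ * ∣ p - q ∣              ≡⟨ *-identityˡ ∣ p - q ∣ ⟩
    ∣ p - q ∣                   ∎
    where
    open ≡-Reasoning
    identity : ∀ σ p q → σ * p - σ * q ≡ σ * (p - q)
    identity = solve-∀ ℚ-ring

  alternating : (ℕ → ℚ) → ℕ → ℕ → ℚ
  alternating t m zero = t m
  alternating t m (suc N) = t m - alternating t (suc m) N

  alternating-snoc : ∀ t m N → alternating t m (suc N) ≡ alternating t m N + sgn (suc N) * t (m ℕ.+ suc N)
  alternating-snoc t m zero = begin
    t m - t (suc m)             ≡⟨ identity (t m) (t (suc m)) ⟩
    t m + sgn 1 * t (suc m)     ≡⟨ cong (λ j → t m + sgn 1 * t j) (ℕP.+-comm 1 m) ⟩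
    t m + sgn 1 * t (m ℕ.+ 1)   ∎
    where
    open ≡-Reasoning
    identity : ∀ p q → p - q ≡ p + (- 1ℚ) * q
    identity = solve-∀ ℚ-ring
  alternating-snoc t m (suc N) = begin
    t m - alternating t (suc m) (suc N)
      ≡⟨ cong (λ p → t m - p) (alternating-snoc t (suc m) N) ⟩
    t m - (alternating t (suc m) N + sgn (suc N) * t (suc m ℕ.+ suc N))
      ≡⟨ identity (t m) _ (sgn (suc N)) _ ⟩
    (t m - alternating t (suc m) N) + (- sgn (suc N)) * t (suc m ℕ.+ suc N)
      ≡⟨ cong₂ (λ σ j → (t m - alternating t (suc m) N) + σ * t j) (sgn-suc (suc N)) (ℕP.+-suc m (suc N)) ⟨
    alternating t m (suc N) + sgn (suc (suc N)) * t (m ℕ.+ suc (suc N)) ∎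
    where
    open ≡-Reasoning
    identity : ∀ p q σ r → p - (q + σ * r) ≡ (p - q) + (- σ) * r
    identity = solve-∀ ℚ-ring

  alternating-shift : ∀ {f g} → (∀ k → f (suc k) ≡ g k) → ∀ m N → alternating f (suc m) N ≡ alternating g m N
  alternating-shift f∘suc≗g m zero = f∘suc≗g m
  alternating-shift f∘suc≗g m (suc N) = cong₂ _-_ (f∘suc≗g m) (alternating-shift f∘suc≗g (suc m) N)

  ∣alternating-drop∣ : ∀ {t} m K M N → ∣ alternating t m (K ℕ.+ M) - alternating t m (K ℕ.+ N) ∣
                                       ≡ ∣ alternating t (K ℕ.+ m) M - alternating t (K ℕ.+ m) N ∣
  ∣alternating-drop∣ m zero M N = refl
  ∣alternating-drop∣ {t} m (suc K) M N = begin
    ∣ (t m - p) - (t m - q) ∣ ≡⟨ cong ∣_∣ (identity (t m) p q) ⟩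
    ∣ - (p - q) ∣             ≡⟨ ∣-p∣≡∣p∣ (p - q) ⟩
    ∣ p - q ∣                 ≡⟨ ∣alternating-drop∣ (suc m) K M N ⟩
    ∣ alternating t (K ℕ.+ suc m) M - alternating t (K ℕ.+ suc m) N ∣
                              ≡⟨ cong (λ j → ∣ alternating t j M - alternating t j N ∣) (ℕP.+-suc K m) ⟩
    ∣ alternating t (suc K ℕ.+ m) M - alternating t (suc K ℕ.+ m) N ∣ ∎
    where
    open ≡-Reasoning
    p = alternating t (suc m) (K ℕ.+ M)
    q = alternating t (suc m) (K ℕ.+ N)
    identity : ∀ r p q → (r - p) - (r - q) ≡ - (p - q)
    identity = solve-∀ ℚ-ring

  module _ {t : ℕ → ℚ} (t-nonneg : ∀ k → 0ℚ ≤ t k) (t-antitone : ∀ k → t (suc k) ≤ t k) where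

    alternating-leibniz : ∀ m N → 0ℚ ≤ alternating t m N × alternating t m N ≤ t m
    alternating-leibniz m zero = t-nonneg m , ≤-refl
    alternating-leibniz m (suc N) with alternating-leibniz (suc m) N
    ... | 0≤a , a≤t = diff-nonneg (≤-trans a≤t (t-antitone m)) , p-q≤p 0≤a

    alternating-cauchy : ∀ m {K M N} → K ℕ.≤ M → K ℕ.≤ N →
                         ∣ alternating t m M - alternating t m N ∣ ≤ t (K ℕ.+ m)
    alternating-cauchy m {K} {M} {N} K≤M K≤N with M ℕ.∸ K | ℕP.m+[n∸m]≡n K≤M | N ℕ.∸ K | ℕP.m+[n∸m]≡n K≤N
    ... | M′ | refl | N′ | refl = subst (_≤ t (K ℕ.+ m)) (sym (∣alternating-drop∣ m K M′ N′))
      (∣p-q∣≤r (proj₁ (alternating-leibniz _ M′)) (proj₂ (alternating-leibniz _ M′))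
               (proj₁ (alternating-leibniz _ N′)) (proj₂ (alternating-leibniz _ N′)))

  module _ {t g : ℕ → ℚ} (t-nonneg : ∀ k → 0ℚ ≤ t k) (g-nonneg : ∀ k → 0ℚ ≤ g k)
           (telescoping : ∀ k → t k + g (suc (suc k)) ≤ g k + t (suc k)) where

    -- Adding the last term t (m + N) to both bounds makes them stable under the recursion
    -- alternating t m (suc N) = t m - alternating t (suc m) N, which swaps lower and upper bound.
    alternating-comparison : ∀ m N → t m - g (suc m) - t (m ℕ.+ N) ≤ alternating t m N
                                   × alternating t m N ≤ g m + t (m ℕ.+ N)
    alternating-comparison m zero rewrite ℕP.+-identityʳ m =
        ≤-by-diff (+-mono-≤ (g-nonneg (suc m)) (t-nonneg m)) (identity (t m) (g (suc m)))
      , ≤-by-diff (g-nonneg m) (identity′ (t m) (g m))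
      where
      identity : ∀ t g → (g + t) - (0ℚ + 0ℚ) ≡ t - (t - g - t)
      identity = solve-∀ ℚ-ring
      identity′ : ∀ t g → g - 0ℚ ≡ (g + t) - t
      identity′ = solve-∀ ℚ-ring
    alternating-comparison m (suc N) rewrite ℕP.+-suc m N with alternating-comparison (suc m) N
    ... | lower , upper =
        ≤-by-diff upper (identity (t m) (g (suc m)) e a)
      , ≤-by-diff (+-mono-≤ (telescoping m) lower) (identity′ (t m) (t (suc m)) (g m) (g (suc (suc m))) e a)
      where
      e = t (suc m ℕ.+ N)
      a = alternating t (suc m) N
      identity : ∀ t g e a → (g + e) - a ≡ (t - a) - (t - g - e)
      identity = solve-∀ ℚ-ring
      identity′ : ∀ t t′ g g″ e a → (g + t′ + a) - (t + g″ + (t′ - g″ - e)) ≡ (g + e) - (t - a)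
      identity′ = solve-∀ ℚ-ring

  -- The series

  τ : ℕ → ℚ
  τ k = frac 1 (b⁺ k ℕ.* b⁺ (suc k))

  -- ρ q u = 1 / (6u² + 1/q)
  ρ : ℕ → ℕ → ℚ
  ρ q u = frac q (1 ℕ.+ 6 ℕ.* q ℕ.* (u ℕ.* u))

  τ-nonneg : ∀ k → 0ℚ ≤ τ k
  τ-nonneg k = frac-nonneg

  τ-antitone : ∀ k → τ (suc k) ≤ τ k
  τ-antitone k = frac-mono-≤ (ℕP.*-monoʳ-≤ 1 (subst (ℕ._≤ y ℕ.* z) (ℕP.*-comm y x) (ℕP.*-monoʳ-≤ y x≤z)))
    where
    x = b⁺ k
    y = b⁺ (suc k)
    z = b⁺ (suc (suc k))
    x≤z = ℕP.<⇒≤ (ℕP.<-trans (b⁺-<-suc k) (b⁺-<-suc (suc k)))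

  τ-ρ-telescoping : ∀ k → τ k + ρ 10 (b⁺ (suc (suc k))) ≤ ρ 10 (b⁺ k) + τ (suc k)
  τ-ρ-telescoping k = subst₂ _≤_ (sym (frac-+ 1 _ 10 _)) (sym (frac-+ 10 _ 1 _))
    (frac-mono-≤ (telescoping-cross (b⁺-recurrence k) (b⁺-cassini k) x≤z 2≤xz))
    where
    x = b⁺ k
    z = b⁺ (suc (suc k))
    x≤z = ℕP.<⇒≤ (ℕP.<-trans (b⁺-<-suc k) (b⁺-<-suc (suc k)))
    2≤xz : 2 ℕ.≤ x ℕ.* z
    2≤xz = ℕP.≤-trans (ℕ.s≤s (ℕ.s≤s ℕ.z≤n))
             (ℕP.≤-trans (ℕP.<⇒≤ (index<b⁺ (suc (suc k)))) (ℕP.m≤n*m z x))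

  ρ-below-τ : ∀ k → ρ 4 (b⁺ k) + ρ 10 (b⁺ (suc k)) ≤ τ k
  ρ-below-τ k = subst (_≤ τ k) (sym (frac-+ 4 _ 10 _))
    (frac-mono-≤ (ρ-below-τ-cross (b⁺-cassini k) (ℕP.<⇒≤ (b⁺-<-suc k))))

  ρ-gap : ∀ q u w {{_ : ℕ.NonZero w}} →
          (1 ℕ.+ 6 ℕ.* q ℕ.* (u ℕ.* u)) ℕ.* (1 ℕ.+ 6 ℕ.* (2 ℕ.* q) ℕ.* (u ℕ.* u)) ℕ.≤ q ℕ.* w →
          ρ q u + frac 1 w ≤ ρ (2 ℕ.* q) u
  ρ-gap q u w hyp = subst (_≤ ρ (2 ℕ.* q) u) (sym (frac-+ q _ 1 w))
    (frac-mono-≤ {{ℕP.m*n≢0 (1 ℕ.+ 6 ℕ.* q ℕ.* (u ℕ.* u)) w}} (ρ-gap-cross q (u ℕ.* u) w hyp))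

  alternating-τ-bounds : ∀ m → Eventually (λ N → ρ 2 (b⁺ m) ≤ alternating τ m N
                                                × alternating τ m N ≤ ρ 20 (b⁺ m))
  alternating-τ-bounds m = W , λ N W≤N → within N (W≤w N W≤N)
    where
    u = b⁺ m
    -- past W, the last term τ (m + N) is small enough for ρ-gap with q = 10 and with q = 2
    W = (1 ℕ.+ 60 ℕ.* (u ℕ.* u)) ℕ.* (1 ℕ.+ 120 ℕ.* (u ℕ.* u))
    W≤w : ∀ N → W ℕ.≤ N → W ℕ.≤ b⁺ (m ℕ.+ N) ℕ.* b⁺ (suc (m ℕ.+ N))
    W≤w N W≤N = ℕP.≤-trans W≤N (ℕP.≤-trans (ℕP.m≤n+m N m)
      (ℕP.≤-trans (ℕP.<⇒≤ (index<b⁺ (m ℕ.+ N))) (ℕP.m≤m*n (b⁺ (m ℕ.+ N)) (b⁺ (suc (m ℕ.+ N))))))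
    within : ∀ N → W ℕ.≤ b⁺ (m ℕ.+ N) ℕ.* b⁺ (suc (m ℕ.+ N)) →
             ρ 2 u ≤ alternating τ m N × alternating τ m N ≤ ρ 20 u
    within N W≤w = lower , ≤-trans (proj₂ comparison) (ρ-gap 10 u w (ℕP.≤-trans W≤w (ℕP.m≤n*m w 10)))
      where
      w = b⁺ (m ℕ.+ N) ℕ.* b⁺ (suc (m ℕ.+ N))
      comparison = alternating-comparison τ-nonneg (λ k → frac-nonneg) τ-ρ-telescoping m N
      small-gap : ρ 2 u + τ (m ℕ.+ N) ≤ ρ 4 u
      small-gap = ρ-gap 2 u w (ℕP.≤-trans (ℕP.*-mono-≤ (ℕP.+-monoʳ-≤ 1 (ℕP.*-monoˡ-≤ (u ℕ.* u) (ℕP.m≤m+n 12 48)))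
                                                      (ℕP.+-monoʳ-≤ 1 (ℕP.*-monoˡ-≤ (u ℕ.* u) (ℕP.m≤m+n 24 96))))
                                        (ℕP.≤-trans W≤w (ℕP.m≤n*m w 2)))
      lower = ≤-by-diff (+-mono-≤ (≤-trans (+-monoˡ-≤ _ small-gap) (ρ-below-τ m)) (proj₁ comparison))
                        (identity (ρ 2 u) (τ (m ℕ.+ N)) (ρ 10 (b⁺ (suc m))) (τ m) (alternating τ m N))
        where
        identity : ∀ r e g t a → (t + a) - ((r + e + g) + (t - g - e)) ≡ a - r
        identity = solve-∀ ℚ-ring

  recip-ρ : ∀ q u → recip (ρ (suc q) u) ≡ frac (1 ℕ.+ 6 ℕ.* suc q ℕ.* (u ℕ.* u)) (suc q)
  recip-ρ q u = recip-frac q _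

  6u²<recip-ρ : ∀ q u → frac (6 ℕ.* (u ℕ.* u)) 1 < recip (ρ (suc q) u)
  6u²<recip-ρ q u = subst (frac (6 ℕ.* (u ℕ.* u)) 1 <_) (sym (recip-ρ q u))
    (frac-mono-< (ℕP.≤-reflexive (identity q (u ℕ.* u))))
    where
    identity : ∀ q v → suc (6 ℕ.* v ℕ.* suc q) ≡ (1 ℕ.+ 6 ℕ.* suc q ℕ.* v) ℕ.* 1
    identity = ℕ-Ring.solve-∀

  recip-ρ<6u²+1 : ∀ q u → recip (ρ (suc (suc q)) u) < frac (6 ℕ.* (u ℕ.* u) ℕ.+ 1) 1
  recip-ρ<6u²+1 q u = subst (_< frac (6 ℕ.* (u ℕ.* u) ℕ.+ 1) 1) (sym (recip-ρ (suc q) u))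
    (frac-mono-< (m+k≡n⇒m≤n q (identity q (u ℕ.* u))))
    where
    identity : ∀ q v → suc ((1 ℕ.+ 6 ℕ.* suc (suc q) ℕ.* v) ℕ.* 1) ℕ.+ q ≡ (6 ℕ.* v ℕ.+ 1) ℕ.* suc (suc q)
    identity = ℕ-Ring.solve-∀

  recip-alternating-τ-bounds : ∀ m → Eventually (λ N → recip (ρ 20 (b⁺ m)) ≤ recip (alternating τ m N)
                                                     × recip (alternating τ m N) ≤ recip (ρ 2 (b⁺ m)))
  recip-alternating-τ-bounds m = proj₁ eventually , λ N N₀≤N →
    reciprocals (proj₁ (proj₂ eventually N N₀≤N)) (proj₂ (proj₂ eventually N N₀≤N))
    where
    eventually = alternating-τ-bounds m
    0<ρ2 : 0ℚ < ρ 2 (b⁺ m)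
    0<ρ2 = frac-pos
    reciprocals : ∀ {a} → ρ 2 (b⁺ m) ≤ a → a ≤ ρ 20 (b⁺ m) →
                  recip (ρ 20 (b⁺ m)) ≤ recip a × recip a ≤ recip (ρ 2 (b⁺ m))
    reciprocals ρ2≤a a≤ρ20 = recip-antitone (<-≤-trans 0<ρ2 ρ2≤a) a≤ρ20 , recip-antitone 0<ρ2 ρ2≤a

  τ-eventually-< : ∀ {ε} → 0ℚ < ε → ∃[ K ] (∀ j → K ℕ.≤ j → τ j < ε)
  τ-eventually-< {ε@(mkℚ ℤ.+[1+ p ] d _)} _ = suc d , λ j K≤j →
    subst (τ j <_) (trans (frac≡/ (suc p) (suc d)) (↥p/↧p≡p ε)) (frac-mono-< (cross j K≤j))
    where
    cross : ∀ j → suc d ℕ.≤ j → 1 ℕ.* suc d ℕ.< suc p ℕ.* (b⁺ j ℕ.* b⁺ (suc j))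
    cross j K≤j = subst (ℕ._< suc p ℕ.* (b⁺ j ℕ.* b⁺ (suc j))) (sym (ℕP.*-identityˡ (suc d)))
      (ℕP.<-≤-trans (ℕP.≤-<-trans K≤j (index<b⁺ j))
        (ℕP.≤-trans (ℕP.m≤m*n (b⁺ j) (b⁺ (suc j))) (ℕP.m≤n*m _ (suc p))))
  τ-eventually-< {mkℚ +0 _ _} 0<ε with drop-*<* 0<ε
  ... | ℤ.+<+ ()
  τ-eventually-< {mkℚ ℤ.-[1+ _ ] _ _} 0<ε with drop-*<* 0<ε
  ... | ()

  -- The partial sums of the statement

  B≡b : ∀ k → B k ≡ + b k
  B≡b zero = refl
  B≡b (suc zero) = refl
  B≡b (suc (suc k)) = begin
    + 6 ℤ.* B (suc k) ℤ.- B k       ≡⟨ cong₂ (λ y x → + 6 ℤ.* y ℤ.- x) (B≡b (suc k)) (B≡b k) ⟩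
    + 6 ℤ.* + b (suc k) ℤ.- + b k   ≡⟨ cong (ℤ._- + b k) (ℤP.pos-* 6 (b (suc k))) ⟨
    + (6 ℕ.* b (suc k)) ℤ.- + b k   ≡⟨ ℤP.m-n≡m⊖n (6 ℕ.* b (suc k)) (b k) ⟩
    (6 ℕ.* b (suc k)) ℤ.⊖ b k       ≡⟨ ℤP.⊖-≥ (b-≤-6* k) ⟩
    + b (suc (suc k))               ∎
    where open ≡-Reasoning

  B-suc≡b⁺ : ∀ k → B (suc k) ≡ + b⁺ k
  B-suc≡b⁺ k = trans (B≡b (suc k)) (cong +_ (sym (b⁺≡b k)))

  unsignedTerm : ℕ → ℚ
  unsignedTerm k = recip ((B k / 1) * (B (suc k) / 1))

  unsignedTerm-suc : ∀ k → unsignedTerm (suc k) ≡ τ k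
  unsignedTerm-suc k = begin
    recip ((B (suc k) / 1) * (B (suc (suc k)) / 1)) ≡⟨ cong₂ (λ y z → recip ((y / 1) * (z / 1)))
                                                              (B-suc≡b⁺ k) (B-suc≡b⁺ (suc k)) ⟩
    recip ((+ x / 1) * (+ y / 1))                   ≡⟨ cong₂ (λ p q → recip (p * q)) (frac≡/ x 1) (frac≡/ y 1) ⟨
    recip (frac x 1 * frac y 1)                     ≡⟨ cong recip (frac-* x 1 y 1) ⟩
    recip (frac (x ℕ.* y) 1)                        ≡⟨ recip-frac _ 0 ⟩
    τ k                                             ∎
    where
    open ≡-Reasoning
    x = b⁺ k
    y = b⁺ (suc k)

  partial≡sgn*alternating : ∀ n N → partial n N ≡ sgn n * alternating unsignedTerm n N
  partial≡sgn*alternating n zero = refl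
  partial≡sgn*alternating n (suc N) = begin
    partial n N + sgn (n ℕ.+ suc N) * r
      ≡⟨ cong₂ (λ p σ → p + σ * r) (partial≡sgn*alternating n N) (sgn-+ n (suc N)) ⟩
    sgn n * alternating unsignedTerm n N + sgn n * sgn (suc N) * r
      ≡⟨ identity (sgn n) _ (sgn (suc N)) r ⟩
    sgn n * (alternating unsignedTerm n N + sgn (suc N) * r)
      ≡⟨ cong (sgn n *_) (alternating-snoc unsignedTerm n N) ⟨
    sgn n * alternating unsignedTerm n (suc N) ∎
    where
    open ≡-Reasoning
    r = unsignedTerm (n ℕ.+ suc N)
    identity : ∀ σ a σ′ r → σ * a + σ * σ′ * r ≡ σ * (a + σ′ * r)
    identity = solve-∀ ℚ-ring

  partial≡sgn*alternating-τ : ∀ m N → partial (suc m) N ≡ sgn (suc m) * alternating τ m N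
  partial≡sgn*alternating-τ m N =
    trans (partial≡sgn*alternating (suc m) N) (cong (sgn (suc m) *_) (alternating-shift unsignedTerm-suc m N))

  partial-cauchy : ∀ m → Cauchy (partial (suc m))
  partial-cauchy m ε 0<ε = K , λ M N K≤M K≤N → begin-strict
    ∣ partial (suc m) M - partial (suc m) N ∣
      ≡⟨ cong₂ (λ p q → ∣ p - q ∣) (partial≡sgn*alternating-τ m M) (partial≡sgn*alternating-τ m N) ⟩
    ∣ sgn (suc m) * alternating τ m M - sgn (suc m) * alternating τ m N ∣
      ≡⟨ ∣sgn*p-sgn*q∣ (suc m) _ _ ⟩
    ∣ alternating τ m M - alternating τ m N ∣
      ≤⟨ alternating-cauchy τ-nonneg τ-antitone m K≤M K≤N ⟩
    τ (K ℕ.+ m)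
      <⟨ proj₂ (τ-eventually-< 0<ε) (K ℕ.+ m) (ℕP.m≤m+n K m) ⟩
    ε ∎
    where
    open ≤-Reasoning
    K = proj₁ (τ-eventually-< 0<ε)

  middle-products : ∀ m → B (suc m) ℤ.* B (suc (suc m)) ℤ.+ B m ℤ.* B (suc m) ≡ + (6 ℕ.* (b⁺ m ℕ.* b⁺ m))
  middle-products m = begin
    B (suc m) ℤ.* (+ 6 ℤ.* B (suc m) ℤ.- B m) ℤ.+ B m ℤ.* B (suc m) ≡⟨ identity (B m) (B (suc m)) ⟩
    + 6 ℤ.* (B (suc m) ℤ.* B (suc m))                             ≡⟨ cong (λ y → + 6 ℤ.* (y ℤ.* y)) (B-suc≡b⁺ m) ⟩
    + 6 ℤ.* (+ u ℤ.* + u)                                         ≡⟨ cong (+ 6 ℤ.*_) (ℤP.pos-* u u) ⟨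
    + 6 ℤ.* + (u ℕ.* u)                                           ≡⟨ ℤP.pos-* 6 (u ℕ.* u) ⟨
    + (6 ℕ.* (u ℕ.* u))                                           ∎
    where
    open ≡-Reasoning
    u = b⁺ m
    identity : ∀ x y → y ℤ.* (+ 6 ℤ.* y ℤ.- x) ℤ.+ x ℤ.* y ≡ + 6 ℤ.* (y ℤ.* y)
    identity = ℤ-Ring.solve-∀

  FloorLimits : (ℕ → ℚ) → ℤ → Set
  FloorLimits s z = LimGE s (z / 1) × LimLT s ((z ℤ.+ + 1) / 1)

  recip-partial-floor : ∀ m → FloorLimits (λ N → recip (partial (suc m) N)) (rhs (suc m))
  recip-partial-floor m = subst (FloorLimits s) (sym rhs≡) (by-parity (isEven (suc m)) refl)
    where
    u = b⁺ m
    c = 6 ℕ.* (u ℕ.* u)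
    s = λ N → recip (partial (suc m) N)
    a = alternating τ m
    rhs≡ : rhs (suc m) ≡ (if isEven (suc m) then + c else ℤ.- (+ c ℤ.+ + 1))
    rhs≡ = cong (λ z → if isEven (suc m) then z else ℤ.- (z ℤ.+ + 1)) (middle-products m)
    N₀ = proj₁ (recip-alternating-τ-bounds m)
    bounds = proj₂ (recip-alternating-τ-bounds m)
    s≡recip-σ* : ∀ {σ} N → sgn (suc m) ≡ σ → s N ≡ recip (σ * a N)
    s≡recip-σ* N refl = cong recip (partial≡sgn*alternating-τ m N)
    by-parity : ∀ β → isEven (suc m) ≡ β → FloorLimits s (if β then + c else ℤ.- (+ c ℤ.+ + 1))
    by-parity true even = subst₂ (λ p q → LimGE s p × LimLT s q) (frac≡/ c 1) (frac≡/ (c ℕ.+ 1) 1)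
        ( eventually-≥⇒LimGE (N₀ , λ N h → subst (frac c 1 ≤_) (sym (s≡recip N))
                                              (≤-trans (<⇒≤ (6u²<recip-ρ 19 u)) (proj₁ (bounds N h))))
        , eventually-≤⇒LimLT (recip-ρ<6u²+1 0 u) (N₀ , λ N h → subst (_≤ recip (ρ 2 u)) (sym (s≡recip N))
                                                                   (proj₂ (bounds N h))))
      where
      s≡recip : ∀ N → s N ≡ recip (a N)
      s≡recip N = trans (s≡recip-σ* N (cong (λ β → if β then 1ℚ else - 1ℚ) even)) (cong recip (*-identityˡ (a N)))
    by-parity false odd = subst₂ (λ p q → LimGE s p × LimLT s q)
        (sym (neg-frac (c ℕ.+ 1))) (sym (trans (cong (_/ 1) (identity (+ c))) (neg-frac c)))
        ( eventually-≥⇒LimGE (N₀ , λ N h → subst (- frac (c ℕ.+ 1) 1 ≤_) (sym (s≡-recip N))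
                                              (neg-antimono-≤ (≤-trans (proj₂ (bounds N h)) (<⇒≤ (recip-ρ<6u²+1 0 u)))))
        , eventually-≤⇒LimLT (neg-antimono-< (6u²<recip-ρ 19 u))
            (N₀ , λ N h → subst (_≤ - recip (ρ 20 u)) (sym (s≡-recip N)) (neg-antimono-≤ (proj₁ (bounds N h)))))
      where
      identity : ∀ z → ℤ.- (z ℤ.+ + 1) ℤ.+ + 1 ≡ ℤ.- z
      identity = ℤ-Ring.solve-∀
      s≡-recip : ∀ N → s N ≡ - recip (a N)
      s≡-recip N = trans (s≡recip-σ* N (cong (λ β → if β then 1ℚ else - 1ℚ) odd))
        (trans (cong recip (trans (sym (neg-distribˡ-* 1ℚ (a N))) (cong -_ (*-identityˡ (a N))))) (recip-neg (a N)))

open import Data.Nat using (ℕ; zero; suc; _≤_)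
open import Data.Product using (_,_)
open AlternatingSeries using (partial-cauchy; recip-partial-floor)

theorem9 : ∀ (n : ℕ) → 1 ≤ n → FloorRecipSeries n (rhs n)
theorem9 zero ()
theorem9 (suc m) _ = partial-cauchy m , recip-partial-floor m
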